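{- For a row $x\ge 1$ of the extended Trithoff array, let $g(x)=T_{x,1}$, $w(x)=T_{x,0}$, $s(x)=T_{x,-1}$, $p(x)=T_{x,-2}$. If the canonical Tribonacci representation of $g(x)$ ends in $11$, then $w(x)=\operatorname{out}(s(x))$ and $s(x)=\operatorname{out}(p(x))+1$. If it ends in $001$, then $w(x)=\operatorname{out}(s(x))+1$ and $s(x)=\operatorname{out}(p(x))$. If it ends in $101$, then $w(x)=\operatorname{out}(s(x))+1$ and $s(x)=\operatorname{out}(p(x))-1$.
   Context: Tribonacci numbers: $T_0=0,T_1=0,T_2=1$, $T_n=T_{n-1}+T_{n-2}+T_{n-3}$ ($n\ge3$). Every $N\ge0$ has a unique canonical Tribonacci representation, a binary word $d_k\cdots d_0$ with no three consecutive $1$s and $N=\sum_i d_iT_{i+3}$; words are padded with leading zeros when needed (so e.g. $1$ is represented as $001$). Tribonacci successor: $\operatorname{out}(N)=\sum_i d_iT_{i+4}$, $\operatorname{out}(0)=0$. Trithoff array: $T_{r,1}$ is the $r$-th smallest positive integer whose canonical representation ends in $1$, $T_{r,c+1}=\operatorname{out}(T_{r,c})$ for $c\ge1$; each row is extended to the left by the Tribonacci rule $T_{r,c}=T_{r,c+3}-T_{r,c+2}-T_{r,c+1}$, giving the wall (column $0$), seed (column $-1$) and pre-seed (column $-2$). -}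

module Defs where

open import Data.Nat using (ℕ; zero; suc; _+_; _*_; _<_)
open import Data.Bool using (Bool; true; false)
open import Data.List using (List; []; _∷_; length)
open import Data.List.Membership.Propositional using (_∈_)
open import Data.List.Relation.Unary.Linked using (Linked)
open import Data.Integer using (ℤ; +_; _-_)
open import Data.Product using (Σ; _×_; ∃)
open import Data.Empty using (⊥)
open import Data.Unit using (⊤)
open import Function.Bundles using (_⇔_)
open import Relation.Binary.PropositionalEquality using (_≡_)

T : ℕ → ℕ
T 0 = 0
T 1 = 0
T 2 = 1
T (suc (suc (suc n))) = T (suc (suc n)) + T (suc n) + T n

-- A binary word d_k ⋯ d_0 is stored LEAST significant digit first:
-- the list  d_0 ∷ d_1 ∷ ⋯ ∷ d_k ∷ [].
bit : Bool → ℕ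
bit true  = 1
bit false = 0

valFrom : ℕ → List Bool → ℕ
valFrom o []       = 0
valFrom o (d ∷ ds) = bit d * T (3 + o) + valFrom (suc o) ds

val : List Bool → ℕ
val = valFrom 0

valSucc : List Bool → ℕ
valSucc = valFrom 1

No111 : List Bool → Set
No111 (true ∷ true ∷ true ∷ _) = ⊥
No111 []       = ⊤
No111 (_ ∷ ds) = No111 ds

Canon : List Bool → ℕ → Set
Canon ds N = No111 ds × val ds ≡ N

-- digit i of a word, padded with leading zeros (i = 0 is the last digit d_0)
digit : List Bool → ℕ → Bool
digit []       _       = false
digit (d ∷ ds) zero    = d
digit (d ∷ ds) (suc i) = digit ds i

EndsIn1 : ℕ → Set
EndsIn1 N = Σ (List Bool) λ ds → Canon ds N × digit ds 0 ≡ true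

-- Out N M  :⇔  out(N) = M, where out(N) = Σ d_i T_{i+4} for the canonical
-- representation d of N (well defined by uniqueness; out(0) = 0 via the empty word).
Out : ℕ → ℕ → Set
Out N M = Σ (List Bool) λ ds → Canon ds N × valSucc ds ≡ M

OutZ : ℤ → ℤ → Set
OutZ a b = Σ ℕ λ A → a ≡ + A × Σ ℕ λ B → Out A B × b ≡ + B

-- n is the r-th smallest positive integer whose canonical representation ends in 1
-- (r ≥ 1): n > 0, n ends in 1, and the positive integers below n whose
-- representation ends in 1 are exactly the entries of a strictly increasing list
-- of length r - 1.
IsNthEndsIn1 : ℕ → ℕ → Set
IsNthEndsIn1 r n =
  0 < n × EndsIn1 n ×
  Σ (List ℕ) λ L → Linked _<_ L × suc (length L) ≡ r ×
    (∀ m → (m ∈ L) ⇔ (0 < m × m < n × EndsIn1 m))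

module Submission where

-- If g = Σ dᵢ T (i + 3) canonically, then out raises every weight by one, so the row of g has columns
-- Σ dᵢ T (i + 2 + c), and running the Tribonacci recurrence backwards the wall, seed and pre-seed are
-- Σ dᵢ T (i + 2), Σ dᵢ T (i + 1) and Σ dᵢ T i. As T 0 = T 1 = 0 and T 2 = T 3 = 1, the three lowest
-- digits of g decide how these sums compare with values of shifted words, whose successors are read
-- off directly, up to one carry 111 ↦ 0001. That out is well defined rests on the uniqueness of
-- canonical representations, which follows because a canonical word of length n has value below T (n + 3).

open import Defs
open import Data.Bool using (Bool; true; false)
open import Data.List using (List; []; _∷_)
open import Data.Product using (_×_; _,_; proj₁; proj₂)
open import Relation.Binary.PropositionalEquality

module CanonicalRepresentation where

  open import Data.Nat using (ℕ; zero; suc; _+_; _*_; _≤_; _<_; z<s)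
  open import Data.Nat.Properties
  open import Data.Nat.Tactic.RingSolver using (solve-∀)
  open import Data.List using (_++_; _∷ʳ_; length; replicate; initLast; _∷ʳ′_)
  open import Data.List.Properties using (length-++; length-replicate)
  open import Relation.Nullary using (contradiction)

  tribSum : ℕ → List Bool → ℕ
  tribSum k []       = 0
  tribSum k (d ∷ ds) = bit d * T k + tribSum (suc k) ds

  valFrom≡tribSum : ∀ o ds → valFrom o ds ≡ tribSum (3 + o) ds
  valFrom≡tribSum o []       = refl
  valFrom≡tribSum o (d ∷ ds) = cong (bit d * T (3 + o) +_) (valFrom≡tribSum (suc o) ds)

  tribSum-rec : ∀ k ds → tribSum (3 + k) ds ≡ tribSum (2 + k) ds + tribSum (1 + k) ds + tribSum k ds
  tribSum-rec k []       = refl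
  tribSum-rec k (d ∷ ds) =
    trans (cong (bit d * T (3 + k) +_) (tribSum-rec (suc k) ds))
          (regroup (bit d) (T (2 + k)) (T (1 + k)) (T k) _ _ _)
    where
    regroup : ∀ b x y z X Y Z →
              b * (x + y + z) + (X + Y + Z) ≡ (b * x + X) + (b * y + Y) + (b * z + Z)
    regroup = solve-∀

  tribSum-++ : ∀ k xs ys → tribSum k (xs ++ ys) ≡ tribSum k xs + tribSum (length xs + k) ys
  tribSum-++ k []       ys = refl
  tribSum-++ k (x ∷ xs) ys = begin
    bit x * T k + tribSum (suc k) (xs ++ ys)
      ≡⟨ cong (bit x * T k +_) (tribSum-++ (suc k) xs ys) ⟩
    bit x * T k + (tribSum (suc k) xs + tribSum (length xs + suc k) ys)
      ≡⟨ sym (+-assoc (bit x * T k) _ _) ⟩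
    bit x * T k + tribSum (suc k) xs + tribSum (length xs + suc k) ys
      ≡⟨ cong (λ i → bit x * T k + tribSum (suc k) xs + tribSum i ys) (+-suc (length xs) k) ⟩
    bit x * T k + tribSum (suc k) xs + tribSum (suc (length xs) + k) ys
      ∎
    where open ≡-Reasoning

  tribSum-replicate-false : ∀ k m → tribSum k (replicate m false) ≡ 0
  tribSum-replicate-false k zero    = refl
  tribSum-replicate-false k (suc m) = tribSum-replicate-false (suc k) m

  tribSum-++-zeros : ∀ k ds m → tribSum k (ds ++ replicate m false) ≡ tribSum k ds
  tribSum-++-zeros k ds m = begin
    tribSum k (ds ++ replicate m false)                             ≡⟨ tribSum-++ k ds _ ⟩
    tribSum k ds + tribSum (length ds + k) (replicate m false)      ≡⟨ cong (tribSum k ds +_) (tribSum-replicate-false _ m) ⟩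
    tribSum k ds + 0                                                ≡⟨ +-identityʳ _ ⟩
    tribSum k ds                                                    ∎
    where open ≡-Reasoning

  tribSum-∷ʳ-true : ∀ k xs → tribSum k (xs ∷ʳ true) ≡ tribSum k xs + T (length xs + k)
  tribSum-∷ʳ-true k xs =
    trans (tribSum-++ k xs _) (cong (tribSum k xs +_) (trans (+-identityʳ _) (+-identityʳ _)))

  No111-++-false∷ : ∀ xs ys → No111 xs → No111 ys → No111 (xs ++ false ∷ ys)
  No111-++-false∷ []                       ys _  q = q
  No111-++-false∷ (false ∷ xs)             ys p  q = No111-++-false∷ xs ys p q
  No111-++-false∷ (true ∷ [])              ys _  q = q
  No111-++-false∷ (true ∷ false ∷ xs)      ys p  q = No111-++-false∷ xs ys p q
  No111-++-false∷ (true ∷ true ∷ [])       ys _  q = q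
  No111-++-false∷ (true ∷ true ∷ false ∷ xs) ys p q = No111-++-false∷ xs ys p q
  No111-++-false∷ (true ∷ true ∷ true ∷ xs) ys () q

  No111-replicate-false : ∀ m → No111 (replicate m false)
  No111-replicate-false zero    = _
  No111-replicate-false (suc m) = No111-replicate-false m

  No111-∷ʳ⁻ : ∀ xs x → No111 (xs ∷ʳ x) → No111 xs
  No111-∷ʳ⁻ []                         x _ = _
  No111-∷ʳ⁻ (false ∷ xs)               x p = No111-∷ʳ⁻ xs x p
  No111-∷ʳ⁻ (true ∷ [])                x _ = _
  No111-∷ʳ⁻ (true ∷ false ∷ xs)        x p = No111-∷ʳ⁻ xs x p
  No111-∷ʳ⁻ (true ∷ true ∷ [])         x _ = _
  No111-∷ʳ⁻ (true ∷ true ∷ false ∷ xs) x p = No111-∷ʳ⁻ xs x p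
  No111-∷ʳ⁻ (true ∷ true ∷ true ∷ xs)  x ()

  m+[n+o]≡n+m+o : ∀ m n o → m + (n + o) ≡ n + m + o
  m+[n+o]≡n+m+o m n o = trans (sym (+-assoc m n o)) (cong (_+ o) (+-comm m n))

  T[2+k]≤T[3+k] : ∀ k → T (2 + k) ≤ T (3 + k)
  T[2+k]≤T[3+k] k = ≤-trans (m≤m+n (T (2 + k)) (T (1 + k))) (m≤m+n _ (T k))

  -- The summand T (2 + k) strengthens the claim just enough for the induction; it is sharp for 11011⋯011.
  tribSum-bound : ∀ k ds → No111 ds → tribSum (3 + k) ds + T (2 + k) ≤ T (length ds + (3 + k))
  tribSum-bound k [] _ = T[2+k]≤T[3+k] k
  tribSum-bound k (false ∷ ds) p = begin
    tribSum (4 + k) ds + T (2 + k)      ≤⟨ +-monoʳ-≤ (tribSum (4 + k) ds) (T[2+k]≤T[3+k] k) ⟩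
    tribSum (4 + k) ds + T (3 + k)      ≤⟨ tribSum-bound (suc k) ds p ⟩
    T (length ds + (4 + k))             ≡⟨ cong T (+-suc (length ds) (3 + k)) ⟩
    T (suc (length ds) + (3 + k))       ∎
    where open ≤-Reasoning
  tribSum-bound k (true ∷ []) _ = begin
    1 * T (3 + k) + 0 + T (2 + k)          ≡⟨ regroup (T (3 + k)) (T (2 + k)) ⟩
    T (3 + k) + T (2 + k)                  ≤⟨ m≤m+n _ (T (1 + k)) ⟩
    T (4 + k)                              ∎
    where
    open ≤-Reasoning
    regroup : ∀ x y → 1 * x + 0 + y ≡ x + y
    regroup = solve-∀
  tribSum-bound k (true ∷ false ∷ ds) p = begin
    1 * T (3 + k) + tribSum (5 + k) ds + T (2 + k)   ≡⟨ regroup (T (3 + k)) (tribSum (5 + k) ds) (T (2 + k)) ⟩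
    tribSum (5 + k) ds + (T (3 + k) + T (2 + k))     ≤⟨ +-monoʳ-≤ (tribSum (5 + k) ds) (m≤m+n _ (T (1 + k))) ⟩
    tribSum (5 + k) ds + T (4 + k)                   ≤⟨ tribSum-bound (2 + k) ds p ⟩
    T (length ds + (5 + k))                          ≡⟨ cong T (m+[n+o]≡n+m+o (length ds) 2 (3 + k)) ⟩
    T (2 + length ds + (3 + k))                      ∎
    where
    open ≤-Reasoning
    regroup : ∀ x y z → 1 * x + y + z ≡ y + (x + z)
    regroup = solve-∀
  tribSum-bound k (true ∷ true ∷ []) _ = ≤-reflexive (regroup (T (3 + k)) (T (4 + k)) (T (2 + k)))
    where
    regroup : ∀ x y z → 1 * x + (1 * y + 0) + z ≡ y + x + z
    regroup = solve-∀
  tribSum-bound k (true ∷ true ∷ false ∷ ds) p = begin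
    1 * T (3 + k) + (1 * T (4 + k) + tribSum (6 + k) ds) + T (2 + k)
      ≡⟨ regroup (T (3 + k)) (T (4 + k)) (tribSum (6 + k) ds) (T (2 + k)) ⟩
    tribSum (6 + k) ds + T (5 + k)                   ≤⟨ tribSum-bound (3 + k) ds p ⟩
    T (length ds + (6 + k))                          ≡⟨ cong T (m+[n+o]≡n+m+o (length ds) 3 (3 + k)) ⟩
    T (3 + length ds + (3 + k))                      ∎
    where
    open ≤-Reasoning
    regroup : ∀ x y V z → 1 * x + (1 * y + V) + z ≡ V + (y + x + z)
    regroup = solve-∀
  tribSum-bound k (true ∷ true ∷ true ∷ ds) ()

  tribSum-<-top : ∀ ds → No111 ds → tribSum 3 ds < T (length ds + 3)
  tribSum-<-top ds p = <-≤-trans (m<m+n (tribSum 3 ds) z<s) (tribSum-bound 0 ds p)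

  m<n⇒o+n≢m : ∀ o {m n} → m < n → o + n ≢ m
  m<n⇒o+n≢m o {n = n} m<n o+n≡m = <⇒≱ m<n (subst (n ≤_) o+n≡m (m≤n+m n o))

  top-digit-unique : ∀ {a b} x y → length a ≡ length b → No111 a → No111 b →
                     tribSum 3 (a ∷ʳ x) ≡ tribSum 3 (b ∷ʳ y) → x ≡ y × tribSum 3 a ≡ tribSum 3 b
  top-digit-unique {a} {b} false false _ _ _ eq =
    refl , trans (sym (tribSum-++-zeros 3 a 1)) (trans eq (tribSum-++-zeros 3 b 1))
  top-digit-unique {a} {b} true true la≡lb _ _ eq =
    refl , +-cancelʳ-≡ _ _ _ (begin
      tribSum 3 a + T (length a + 3)   ≡⟨ sym (tribSum-∷ʳ-true 3 a) ⟩
      tribSum 3 (a ∷ʳ true)            ≡⟨ eq ⟩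
      tribSum 3 (b ∷ʳ true)            ≡⟨ tribSum-∷ʳ-true 3 b ⟩
      tribSum 3 b + T (length b + 3)   ≡⟨ cong (λ l → tribSum 3 b + T (l + 3)) (sym la≡lb) ⟩
      tribSum 3 b + T (length a + 3)   ∎)
    where open ≡-Reasoning
  top-digit-unique {a} {b} true false la≡lb _ pb eq =
    contradiction (trans (sym (tribSum-∷ʳ-true 3 a)) (trans eq (tribSum-++-zeros 3 b 1)))
                  (m<n⇒o+n≢m _ (subst (λ l → tribSum 3 b < T (l + 3)) (sym la≡lb) (tribSum-<-top b pb)))
  top-digit-unique {a} {b} false true la≡lb pa _ eq =
    contradiction (trans (sym (tribSum-∷ʳ-true 3 b)) (trans (sym eq) (tribSum-++-zeros 3 a 1)))
                  (m<n⇒o+n≢m _ (subst (λ l → tribSum 3 a < T (l + 3)) la≡lb (tribSum-<-top a pa)))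

  length-∷ʳ : ∀ (xs : List Bool) x → length (xs ∷ʳ x) ≡ suc (length xs)
  length-∷ʳ xs x = trans (length-++ xs) (+-comm (length xs) 1)

  canonical-injective : ∀ n {a b} → length a ≡ n → length b ≡ n → No111 a → No111 b →
                        tribSum 3 a ≡ tribSum 3 b → a ≡ b
  canonical-injective zero {[]} {[]} _ _ _ _ _ = refl
  canonical-injective (suc n) {a} {b} la lb pa pb eq with initLast a | initLast b
  ... | []      | _       = contradiction la 0≢1+n
  ... | _ ∷ʳ′ _ | []      = contradiction lb 0≢1+n
  ... | a ∷ʳ′ x | b ∷ʳ′ y =
    cong₂ _∷ʳ_ (canonical-injective n la′ lb′ pa′ pb′ (proj₂ top)) (proj₁ top)
    where
    la′ : length a ≡ n
    la′ = suc-injective (trans (sym (length-∷ʳ a x)) la)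
    lb′ : length b ≡ n
    lb′ = suc-injective (trans (sym (length-∷ʳ b y)) lb)
    pa′ : No111 a
    pa′ = No111-∷ʳ⁻ a x pa
    pb′ : No111 b
    pb′ = No111-∷ʳ⁻ b y pb
    top : x ≡ y × tribSum 3 a ≡ tribSum 3 b
    top = top-digit-unique {a} {b} x y (trans la′ (sym lb′)) pa′ pb′ eq

  length-++-zeros : ∀ (xs : List Bool) m → length (xs ++ replicate m false) ≡ length xs + m
  length-++-zeros xs m = trans (length-++ xs) (cong (length xs +_) (length-replicate m))

  canonical-unique : ∀ {a b} → No111 a → No111 b → tribSum 3 a ≡ tribSum 3 b →
                     ∀ k → tribSum k a ≡ tribSum k b
  canonical-unique {a} {b} pa pb eq k = begin
    tribSum k a                        ≡⟨ sym (tribSum-++-zeros k a (suc (length b))) ⟩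
    tribSum k (a ++ zeros (length b))  ≡⟨ cong (tribSum k) padded ⟩
    tribSum k (b ++ zeros (length a))  ≡⟨ tribSum-++-zeros k b (suc (length a)) ⟩
    tribSum k b                        ∎
    where
    open ≡-Reasoning
    zeros : ℕ → List Bool
    zeros m = replicate (suc m) false
    padded : a ++ zeros (length b) ≡ b ++ zeros (length a)
    padded = canonical-injective (suc (length b + length a))
      (trans (length-++-zeros a _) (+-comm (length a) (suc (length b))))
      (trans (length-++-zeros b _) (+-suc (length b) (length a)))
      (No111-++-false∷ a _ pa (No111-replicate-false (length b)))
      (No111-++-false∷ b _ pb (No111-replicate-false (length a)))
      (trans (tribSum-++-zeros 3 a _) (trans eq (sym (tribSum-++-zeros 3 b _))))

  Out-determined : ∀ {N M} ds → Canon ds N → Out N M → tribSum 4 ds ≡ M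
  Out-determined {M = M} ds (p , val≡N) (ds′ , (p′ , val′≡N) , valSucc′≡M) = begin
    tribSum 4 ds   ≡⟨ canonical-unique {ds} {ds′} p p′ same-value 4 ⟩
    tribSum 4 ds′  ≡⟨ sym (valFrom≡tribSum 1 ds′) ⟩
    valSucc ds′    ≡⟨ valSucc′≡M ⟩
    M              ∎
    where
    open ≡-Reasoning
    same-value : tribSum 3 ds ≡ tribSum 3 ds′
    same-value = trans (sym (valFrom≡tribSum 0 ds))
                       (trans val≡N (trans (sym val′≡N) (valFrom≡tribSum 0 ds′)))

  first-columns-tribSum : ∀ {g c₂ c₃} ds → Canon ds g → Out g c₂ → Out c₂ c₃ →
                          tribSum 3 ds ≡ g × tribSum 4 ds ≡ c₂ × tribSum 5 ds ≡ c₃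
  first-columns-tribSum {c₂ = c₂} ds canon@(p , val≡g) out₁ out₂ =
    trans (sym (valFrom≡tribSum 0 ds)) val≡g ,
    c₂≡ ,
    Out-determined (false ∷ ds) (p , trans (valFrom≡tribSum 1 ds) c₂≡) out₂
    where
    c₂≡ : tribSum 4 ds ≡ c₂
    c₂≡ = Out-determined ds canon out₁

  canonical-Out : ∀ ds → No111 ds → Out (tribSum 3 ds) (tribSum 4 ds)
  canonical-Out ds p = ds , (p , valFrom≡tribSum 0 ds) , valFrom≡tribSum 1 ds

  -- Writing a 1 below a canonical word, carrying 111 ↦ 0001 (as T k + T (1 + k) + T (2 + k) = T (3 + k)).
  prependOne : List Bool → List Bool
  prependOne (true ∷ true ∷ [])         = false ∷ false ∷ false ∷ true ∷ []
  prependOne (true ∷ true ∷ false ∷ ds) = false ∷ false ∷ false ∷ prependOne ds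
  prependOne ds                         = true ∷ ds

  1*m+n≡m+n : ∀ m n → 1 * m + n ≡ m + n
  1*m+n≡m+n m n = cong (_+ n) (*-identityˡ m)

  tribSum-prependOne : ∀ k ds → tribSum k (prependOne ds) ≡ T k + tribSum (suc k) ds
  tribSum-prependOne k (true ∷ true ∷ []) = carry (T k) (T (1 + k)) (T (2 + k))
    where
    carry : ∀ x y z → 1 * (z + y + x) + 0 ≡ x + (1 * y + (1 * z + 0))
    carry = solve-∀
  tribSum-prependOne k (true ∷ true ∷ false ∷ ds) =
    trans (tribSum-prependOne (3 + k) ds) (carry (T k) (T (1 + k)) (T (2 + k)) (tribSum (4 + k) ds))
    where
    carry : ∀ x y z V → z + y + x + V ≡ x + (1 * y + (1 * z + V))
    carry = solve-∀
  tribSum-prependOne k []                        = 1*m+n≡m+n (T k) _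
  tribSum-prependOne k (false ∷ ds)              = 1*m+n≡m+n (T k) _
  tribSum-prependOne k (true ∷ [])               = 1*m+n≡m+n (T k) _
  tribSum-prependOne k (true ∷ false ∷ ds)       = 1*m+n≡m+n (T k) _
  tribSum-prependOne k (true ∷ true ∷ true ∷ ds) = 1*m+n≡m+n (T k) _

  No111-prependOne : ∀ ds → No111 ds → No111 (prependOne ds)
  No111-prependOne (true ∷ true ∷ false ∷ ds) p = No111-prependOne ds p
  No111-prependOne []                         p = p
  No111-prependOne (false ∷ ds)               p = p
  No111-prependOne (true ∷ [])                p = p
  No111-prependOne (true ∷ false ∷ ds)        p = p
  No111-prependOne (true ∷ true ∷ [])         p = p

  -- out (N + 1) = out N + 2 when the representation of N ends in 0.
  Out-prependOne : ∀ ds → No111 ds → Out (suc (tribSum 4 ds)) (2 + tribSum 5 ds)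
  Out-prependOne ds p = subst₂ Out (tribSum-prependOne 3 ds) (tribSum-prependOne 4 ds)
                                   (canonical-Out (prependOne ds) (No111-prependOne ds p))

  -- out (N + 1) = out N + 2 when the representation of N does not end in 11.
  Out-suc : ∀ ds → No111 (true ∷ ds) → Out (suc (tribSum 3 ds)) (2 + tribSum 4 ds)
  Out-suc []                  _ = Out-prependOne [] _
  Out-suc (false ∷ ds)        p = Out-prependOne ds p
  Out-suc (true ∷ [])         _ = Out-suc (true ∷ false ∷ []) _
  Out-suc (true ∷ false ∷ ds) p =
    subst₂ Out (tribSum-prependOne 4 ds) (tribSum-prependOne 5 ds)
               (canonical-Out (false ∷ prependOne ds) (No111-prependOne ds p))
  Out-suc (true ∷ true ∷ ds)  ()

open CanonicalRepresentation
open import Data.Nat as ℕ using (ℕ; suc; _≥_)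
import Data.Nat.Properties as ℕ
open import Data.Integer using (ℤ; +_; _-_; _+_)
open import Data.Integer.Properties using (pos-+)
import Data.Integer.Tactic.RingSolver as ℤ-Solver

Out⇒OutZ : ∀ {A B} → Out A B → OutZ (+ A) (+ B)
Out⇒OutZ {A} {B} out = A , refl , B , out , refl

+[m+n+o]-m-n≡o : ∀ m n o → + (m ℕ.+ n ℕ.+ o) - + m - + n ≡ + o
+[m+n+o]-m-n≡o m n o = begin
  + (m ℕ.+ n ℕ.+ o) - + m - + n
    ≡⟨ cong (λ i → i - + m - + n) (trans (pos-+ (m ℕ.+ n) o) (cong (_+ + o) (pos-+ m n))) ⟩
  + m + + n + + o - + m - + n     ≡⟨ cancel (+ m) (+ n) (+ o) ⟩
  + o                             ∎
  where
  open ≡-Reasoning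
  cancel : ∀ x y z → x + y + z - x - y ≡ z
  cancel = ℤ-Solver.solve-∀

extension : ℕ → ℕ → ℕ → ℤ × ℤ × ℤ
extension g c₂ c₃ =
  let w = + c₃ - + c₂ - + g
      s = + c₂ - + g - w
      p = + g - w - s
  in w , s , p

extension-tribSum : ∀ ds → extension (tribSum 3 ds) (tribSum 4 ds) (tribSum 5 ds)
                         ≡ (+ tribSum 2 ds , + tribSum 1 ds , + tribSum 0 ds)
extension-tribSum ds = cong₂ _,_ w≡ (cong₂ _,_ s≡ p≡)
  where
  W : ℕ → ℤ
  W k = + tribSum k ds
  backward : ∀ k → W (3 ℕ.+ k) - W (2 ℕ.+ k) - W (1 ℕ.+ k) ≡ W k
  backward k =
    trans (cong (λ n → + n - W (2 ℕ.+ k) - W (1 ℕ.+ k)) (tribSum-rec k ds))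
          (+[m+n+o]-m-n≡o (tribSum (2 ℕ.+ k) ds) (tribSum (1 ℕ.+ k) ds) (tribSum k ds))
  w≡ : W 5 - W 4 - W 3 ≡ W 2
  w≡ = backward 2
  s≡ : W 4 - W 3 - (W 5 - W 4 - W 3) ≡ W 1
  s≡ = trans (cong (W 4 - W 3 -_) w≡) (backward 1)
  p≡ : W 3 - (W 5 - W 4 - W 3) - (W 4 - W 3 - (W 5 - W 4 - W 3)) ≡ W 0
  p≡ = trans (cong₂ (λ w s → W 3 - w - s) w≡ s≡) (backward 0)

extension-of-representation : ∀ {g c₂ c₃} ds → Canon ds g → Out g c₂ → Out c₂ c₃ →
                              extension g c₂ c₃ ≡ (+ tribSum 2 ds , + tribSum 1 ds , + tribSum 0 ds)
extension-of-representation ds canon out₁ out₂ with first-columns-tribSum ds canon out₁ out₂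
... | refl , refl , refl = extension-tribSum ds

Ends11Law : ℤ × ℤ × ℤ → Set
Ends11Law (w , s , p) = OutZ s w × OutZ p (s - + 1)

Ends001Law : ℤ × ℤ × ℤ → Set
Ends001Law (w , s , p) = OutZ s (w - + 1) × OutZ p s

Ends101Law : ℤ × ℤ × ℤ → Set
Ends101Law (w , s , p) = OutZ s (w - + 1) × OutZ p (s + + 1)

-- A word shorter than three digits is sent to its padding with zeros, which has the same sums.
ends11-law : ∀ ds → No111 ds → digit ds 0 ≡ true → digit ds 1 ≡ true →
             Ends11Law (+ tribSum 2 ds , + tribSum 1 ds , + tribSum 0 ds)
ends11-law (true ∷ true ∷ [])         _  refl refl = ends11-law (true ∷ true ∷ false ∷ []) _ refl refl
ends11-law (true ∷ true ∷ false ∷ ds) p  refl refl =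
  Out⇒OutZ (Out-prependOne ds p) , Out⇒OutZ (canonical-Out ds p)
ends11-law (true ∷ true ∷ true ∷ ds)  () refl refl

ends001-law : ∀ ds → No111 ds → digit ds 0 ≡ true → digit ds 1 ≡ false → digit ds 2 ≡ false →
              Ends001Law (+ tribSum 2 ds , + tribSum 1 ds , + tribSum 0 ds)
ends001-law (true ∷ [])                _ refl refl refl = ends001-law (true ∷ false ∷ false ∷ []) _ refl refl refl
ends001-law (true ∷ false ∷ [])        _ refl refl refl = ends001-law (true ∷ false ∷ false ∷ []) _ refl refl refl
ends001-law (true ∷ false ∷ false ∷ ds) p refl refl refl =
  Out⇒OutZ (canonical-Out (false ∷ ds) p) , Out⇒OutZ (canonical-Out ds p)

ends101-law : ∀ ds → No111 ds → digit ds 0 ≡ true → digit ds 1 ≡ false → digit ds 2 ≡ true →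
              Ends101Law (+ tribSum 2 ds , + tribSum 1 ds , + tribSum 0 ds)
ends101-law (true ∷ false ∷ true ∷ ds) p refl refl refl =
  Out⇒OutZ (canonical-Out (true ∷ ds) p) ,
  Out⇒OutZ (subst (Out _) (ℕ.+-comm 1 (suc (tribSum 4 ds))) (Out-suc ds p))

-- The row index x plays no role: the laws hold for every g whose first successors are c2 and c3.
mainTheorem13 : (x g c2 c3 : ℕ) → x ≥ 1 → IsNthEndsIn1 x g → Out g c2 → Out c2 c3 →
    let w = + c3 - + c2 - + g
        s = + c2 - + g - w
        p = + g - w - s
    in ((ds : List Bool) → Canon ds g → digit ds 0 ≡ true → digit ds 1 ≡ true →
          OutZ s w × OutZ p (s - + 1))
     × ((ds : List Bool) → Canon ds g → digit ds 0 ≡ true → digit ds 1 ≡ false → digit ds 2 ≡ false →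
          OutZ s (w - + 1) × OutZ p s)
     × ((ds : List Bool) → Canon ds g → digit ds 0 ≡ true → digit ds 1 ≡ false → digit ds 2 ≡ true →
          OutZ s (w - + 1) × OutZ p (s + + 1))
mainTheorem13 _ g c2 c3 _ _ out₁ out₂ =
    (λ ds canon d₀ d₁ → at ds canon Ends11Law (ends11-law ds (proj₁ canon) d₀ d₁))
  , (λ ds canon d₀ d₁ d₂ → at ds canon Ends001Law (ends001-law ds (proj₁ canon) d₀ d₁ d₂))
  , (λ ds canon d₀ d₁ d₂ → at ds canon Ends101Law (ends101-law ds (proj₁ canon) d₀ d₁ d₂))
  where
  at : ∀ ds → Canon ds g → (P : ℤ × ℤ × ℤ → Set) →
       P (+ tribSum 2 ds , + tribSum 1 ds , + tribSum 0 ds) → P (extension g c2 c3)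
  at ds canon P = subst P (sym (extension-of-representation ds canon out₁ out₂))
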